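{- Let $n \geq 2$ and let $x, y, u, v$ be vertices of $LTQ_n$ with $\mathrm{Dim}(x,u) = \mathrm{Dim}(y,v) = n-1$. If $x$ and $y$ are adjacent, then $u$ and $v$ are adjacent and $\mathrm{Dim}(u,v) = \mathrm{Dim}(x,y)$.
   Context: The $n$-dimensional locally twisted cube $LTQ_n$ ($n \geq 2$) is the graph defined recursively as follows. Its vertices are the binary strings $x_1x_2\cdots x_n$ of length $n$. $LTQ_2$ is the 4-cycle $Q_2$ on $\{00,01,10,11\}$ (two strings adjacent iff they differ in exactly one bit). For $n \geq 3$, $LTQ_n$ is obtained from two disjoint copies of $LTQ_{n-1}$: one copy obtained by prefixing every vertex label with $0$, the other by prefixing every vertex label with $1$ (edges inside each copy are kept), and additionally each vertex $0x_2x_3\cdots x_n$ is joined to the vertex $1(x_2+x_n)x_3\cdots x_n$, where $+$ denotes addition modulo 2. For distinct vertices $x, y$, $\lambda(x,y)$ denotes the smallest index $i$ with $x_i \neq y_i$, and $\mathrm{Dim}(x,y) = \lambda(x,y)$ if $x$ and $y$ are adjacent, $\mathrm{Dim}(x,y) = \infty$ otherwise. -}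

module Defs where

open import Data.Bool using (Bool; true; false; _xor_; _∧_; not; if_then_else_; T)
open import Data.Nat using (ℕ; zero; suc)
open import Data.Maybe using (Maybe; just; nothing; map)
open import Data.Vec using (Vec; []; _∷_; last)

-- Vertices of LTQ_n are binary strings x₁x₂⋯xₙ, represented as Vec Bool n
-- with x₁ the head.  We index by m with n = 2 + m, enforcing n ≥ 2.

eqV : ∀ {k} → Vec Bool k → Vec Bool k → Bool
eqV [] [] = true
eqV (a ∷ xs) (b ∷ ys) = not (a xor b) ∧ eqV xs ys

twist : ∀ {k} → Vec Bool (suc (suc k)) → Vec Bool (suc (suc k))
twist (a ∷ xs) = (a xor last xs) ∷ xs

adj : (m : ℕ) → Vec Bool (suc (suc m)) → Vec Bool (suc (suc m)) → Bool
adj zero (a ∷ b ∷ []) (c ∷ d ∷ []) = (a xor c) xor (b xor d)   -- Q₂: differ in exactly one bit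
adj (suc m) (false ∷ x) (false ∷ y) = adj m x y
adj (suc m) (true ∷ x) (true ∷ y) = adj m x y
adj (suc m) (false ∷ x) (true ∷ y) = eqV (twist x) y   -- 0x₂⋯xₙ ~ 1(x₂+xₙ)x₃⋯xₙ
adj (suc m) (true ∷ x) (false ∷ y) = eqV (twist y) x

Adjacent : (m : ℕ) → Vec Bool (suc (suc m)) → Vec Bool (suc (suc m)) → Set
Adjacent m x y = T (adj m x y)

-- λ(x,y): smallest (1-based) index i with xᵢ ≠ yᵢ; nothing if x = y.
firstDiff : ∀ {k} → Vec Bool k → Vec Bool k → Maybe ℕ
firstDiff [] [] = nothing
firstDiff (a ∷ xs) (b ∷ ys) = if a xor b then just 1 else map suc (firstDiff xs ys)

-- Dim(x,y) = λ(x,y) if adjacent, ∞ (represented by nothing) otherwise.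
Dim : (m : ℕ) → Vec Bool (suc (suc m)) → Vec Bool (suc (suc m)) → Maybe ℕ
Dim m x y = if adj m x y then firstDiff x y else nothing

module Submission where

-- In LTQ_n (n = m + 2) the neighbour of a vertex x across
-- dimension n-1 is unique: it is x with its (n-1)-th bit flipped.  Indeed an
-- edge between the two halves (prefix 0 versus prefix 1) has Dim = 1 < n-1, so
-- the edge x–u lies inside one half and we recurse down to LTQ_2 = Q_2, where
-- the claim is checked by enumeration.  Hence u = flipPenult x, v = flipPenult y.
-- Flipping the penultimate bit is a graph automorphism of LTQ_n that also
-- preserves the first index where two strings differ: it commutes with the
-- twist (x₂⋯xₙ ↦ (x₂+xₙ)x₃⋯xₙ only reads the last bit, which it keeps) and with
-- bitwise comparison.  So adj u v = adj x y and λ(u,v) = λ(x,y), which is the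
-- theorem.

open import Defs
open import Data.Bool using (Bool; true; false; _xor_; not; if_then_else_)
open import Data.Bool.Properties using (not-distribˡ-xor; not-distribʳ-xor; not-involutive)
open import Data.Nat using (ℕ; suc; zero)
open import Data.Maybe using (Maybe; just; nothing; map)
open import Data.Vec using (Vec; []; _∷_; last)
open import Data.Product using (_×_; _,_)
open import Relation.Binary.PropositionalEquality using (_≡_; _≢_; refl; cong; sym)
open Relation.Binary.PropositionalEquality.≡-Reasoning

not-xor-not : ∀ a c → not a xor not c ≡ a xor c
not-xor-not a c = begin
  not a xor not c     ≡⟨ not-distribˡ-xor a (not c) ⟨
  not (a xor not c)   ≡⟨ cong not (not-distribʳ-xor a c) ⟨
  not (not (a xor c)) ≡⟨ not-involutive (a xor c) ⟩
  a xor c             ∎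

-- The neighbour of x across dimension n-1: flip the penultimate bit x_{n-1}.
flipPenult : ∀ {k} → Vec Bool (suc (suc k)) → Vec Bool (suc (suc k))
flipPenult {zero}  (a ∷ b ∷ []) = not a ∷ b ∷ []
flipPenult {suc k} (a ∷ x)      = a ∷ flipPenult x

-- Inside one half, Dim is the Dim of the suffixes shifted by one.
dim-within-half : ∀ b (fd : Maybe ℕ) k
  → (if b then map suc fd else nothing) ≡ just (suc k)
  → (if b then fd else nothing) ≡ just k
dim-within-half true (just j) k refl = refl

-- An edge between the two halves has Dim 1, never a larger dimension.
dim-across-halves : ∀ b k → (if b then just 1 else nothing) ≢ just (suc (suc k))
dim-across-halves true  k ()
dim-across-halves false k ()

-- In LTQ_n the only vertex u with Dim(x,u) = n-1 is flipPenult x.  In LTQ_2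
-- this is a finite check; for n > 2 the edge must stay inside one half.
dim-penult-unique : ∀ m (x u : Vec Bool (suc (suc m)))
  → Dim m x u ≡ just (suc m) → u ≡ flipPenult x
dim-penult-unique zero (false ∷ false ∷ []) (true  ∷ false ∷ []) _ = refl
dim-penult-unique zero (false ∷ true  ∷ []) (true  ∷ true  ∷ []) _ = refl
dim-penult-unique zero (true  ∷ false ∷ []) (false ∷ false ∷ []) _ = refl
dim-penult-unique zero (true  ∷ true  ∷ []) (false ∷ true  ∷ []) _ = refl
dim-penult-unique zero (false ∷ false ∷ []) (false ∷ false ∷ []) ()
dim-penult-unique zero (false ∷ false ∷ []) (false ∷ true  ∷ []) ()
dim-penult-unique zero (false ∷ false ∷ []) (true  ∷ true  ∷ []) ()
dim-penult-unique zero (false ∷ true  ∷ []) (false ∷ false ∷ []) ()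
dim-penult-unique zero (false ∷ true  ∷ []) (false ∷ true  ∷ []) ()
dim-penult-unique zero (false ∷ true  ∷ []) (true  ∷ false ∷ []) ()
dim-penult-unique zero (true  ∷ false ∷ []) (false ∷ true  ∷ []) ()
dim-penult-unique zero (true  ∷ false ∷ []) (true  ∷ false ∷ []) ()
dim-penult-unique zero (true  ∷ false ∷ []) (true  ∷ true  ∷ []) ()
dim-penult-unique zero (true  ∷ true  ∷ []) (false ∷ false ∷ []) ()
dim-penult-unique zero (true  ∷ true  ∷ []) (true  ∷ false ∷ []) ()
dim-penult-unique zero (true  ∷ true  ∷ []) (true  ∷ true  ∷ []) ()
dim-penult-unique (suc m) (false ∷ x) (false ∷ u) e =
  cong (false ∷_) (dim-penult-unique m x u (dim-within-half (adj m x u) (firstDiff x u) (suc m) e))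
dim-penult-unique (suc m) (true ∷ x) (true ∷ u) e =
  cong (true ∷_) (dim-penult-unique m x u (dim-within-half (adj m x u) (firstDiff x u) (suc m) e))
dim-penult-unique (suc m) (false ∷ x) (true ∷ u) e with () ← dim-across-halves (eqV (twist x) u) m e
dim-penult-unique (suc m) (true ∷ x) (false ∷ u) e with () ← dim-across-halves (eqV (twist u) x) m e

-- flipPenult keeps the last bit, so it commutes with the twist x₂ ↦ x₂ + xₙ.
last-flipPenult : ∀ {k} (x : Vec Bool (suc (suc k))) → last (flipPenult x) ≡ last x
last-flipPenult {zero}  (a ∷ b ∷ []) = refl
last-flipPenult {suc k} (a ∷ x)      = last-flipPenult x

twist-flipPenult : ∀ {k} (x : Vec Bool (suc (suc k))) → twist (flipPenult x) ≡ flipPenult (twist x)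
twist-flipPenult {zero}  (a ∷ b ∷ []) = cong (_∷ b ∷ []) (sym (not-distribˡ-xor a b))
twist-flipPenult {suc k} (a ∷ x)      = cong (λ l → (a xor l) ∷ flipPenult x) (last-flipPenult x)

eqV-flipPenult : ∀ {k} (x y : Vec Bool (suc (suc k))) → eqV (flipPenult x) (flipPenult y) ≡ eqV x y
eqV-flipPenult {zero}  (a ∷ b ∷ []) (c ∷ d ∷ []) rewrite not-xor-not a c = refl
eqV-flipPenult {suc k} (a ∷ x) (c ∷ y) rewrite eqV-flipPenult x y = refl

firstDiff-flipPenult : ∀ {k} (x y : Vec Bool (suc (suc k)))
  → firstDiff (flipPenult x) (flipPenult y) ≡ firstDiff x y
firstDiff-flipPenult {zero}  (a ∷ b ∷ []) (c ∷ d ∷ []) rewrite not-xor-not a c = refl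
firstDiff-flipPenult {suc k} (a ∷ x) (c ∷ y) rewrite firstDiff-flipPenult x y = refl

adj-flipPenult : ∀ m (x y : Vec Bool (suc (suc m))) → adj m (flipPenult x) (flipPenult y) ≡ adj m x y
adj-flipPenult zero (a ∷ b ∷ []) (c ∷ d ∷ []) rewrite not-xor-not a c = refl
adj-flipPenult (suc m) (false ∷ x) (false ∷ y) = adj-flipPenult m x y
adj-flipPenult (suc m) (true  ∷ x) (true  ∷ y) = adj-flipPenult m x y
adj-flipPenult (suc m) (false ∷ x) (true  ∷ y) rewrite twist-flipPenult x = eqV-flipPenult (twist x) y
adj-flipPenult (suc m) (true  ∷ x) (false ∷ y) rewrite twist-flipPenult y = eqV-flipPenult (twist y) x

mainTheorem6 : (m : ℕ) → (x y u v : Vec Bool (suc (suc m)))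
    → Dim m x u ≡ just (suc m) → Dim m y v ≡ just (suc m)
    → Adjacent m x y
    → Adjacent m u v × Dim m u v ≡ Dim m x y
mainTheorem6 m x y u v dim-xu dim-yv x~y
  rewrite dim-penult-unique m x u dim-xu
        | dim-penult-unique m y v dim-yv
        | adj-flipPenult m x y
        | firstDiff-flipPenult x y
  = x~y , refl
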